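{- Let $G$ be a cactus graph on $n\geq 4$ vertices with at least two cycles, and suppose $G$ contains a $4$-cycle $C$ having two adjacent vertices each of which has a neighbor not on $C$. Then $\operatorname{Z}(\overline{G})=n-4$.
   Context: All graphs are finite, simple and undirected. A cactus graph is a connected graph in which any two simple cycles have at most one vertex in common. $\overline{G}$ denotes the complement of $G$ (same vertex set; distinct vertices adjacent iff not adjacent in $G$). Zero forcing: given an initial set $B\subseteq V(G)$ of blue vertices (all others white), a blue vertex with exactly one white neighbor may turn that neighbor blue; $B$ is a zero forcing set if repeated application makes all vertices blue. $\operatorname{Z}(G)$ is the minimum size of a zero forcing set of $G$. -}

module Defs where

open import Data.Nat using (ℕ; _≤_)
open import Data.Fin using (Fin)
open import Data.Fin.Subset using (Subset; _∈_; ∣_∣)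
open import Data.List using (List; []; _∷_; _++_; [_]; zip; length)
open import Data.List.Relation.Unary.All using (All)
open import Data.List.Relation.Unary.Unique.Propositional using (Unique)
import Data.List.Membership.Propositional as LM
open import Data.Product using (_×_; _,_; Σ; ∃; ∃-syntax)
open import Data.Sum using (_⊎_)
open import Relation.Nullary using (¬_; Dec)
open import Relation.Binary.PropositionalEquality using (_≡_; _≢_)
open import Function.Bundles using (_⇔_)

record Graph (n : ℕ) : Set₁ where
  field
    Adj   : Fin n → Fin n → Set
    dec   : ∀ u v → Dec (Adj u v)
    sym   : ∀ {u v} → Adj u v → Adj v u
    irrefl : ∀ {u} → ¬ Adj u u
open Graph public

complement : ∀ {n} → Graph n → Graph n
complement {n} G = record
  { Adj = λ u v → (u ≢ v) × ¬ Adj G u v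
  ; dec = dec'
  ; sym = λ { (u≢v , ¬a) → (λ e → u≢v (Relation.Binary.PropositionalEquality.sym e)) , (λ a → ¬a (Graph.sym G a)) }
  ; irrefl = λ { (u≢u , _) → u≢u Relation.Binary.PropositionalEquality.refl }
  }
  where
  open import Relation.Nullary using (yes; no)
  open import Data.Fin using (_≟_)
  dec' : ∀ u v → Dec ((u ≢ v) × ¬ Adj G u v)
  dec' u v with u ≟ v | Graph.dec G u v
  ... | yes e | _ = no λ { (ne , _) → ne e }
  ... | no ne | yes a = no λ { (_ , na) → na a }
  ... | no ne | no na = yes (ne , na)

data Reach {n} (G : Graph n) (u : Fin n) : Fin n → Set where
  here : Reach G u u
  step : ∀ {v w} → Reach G u v → Adj G v w → Reach G u w

Connected : ∀ {n} → Graph n → Set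
Connected G = ∀ u v → Reach G u v

-- Cyclic edge list of a vertex sequence v₀ … v_{k-1}: (vᵢ , vᵢ₊₁) and (v_{k-1} , v₀).
cycEdges : ∀ {A : Set} → List A → List (A × A)
cycEdges []       = []
cycEdges (v ∷ vs) = zip (v ∷ vs) (vs ++ [ v ])

record Cycle {n} (G : Graph n) : Set where
  field
    verts    : List (Fin n)
    len≥3    : 3 ≤ length verts
    distinct : Unique verts
    closed   : All (λ e → Adj G (Data.Product.proj₁ e) (Data.Product.proj₂ e)) (cycEdges verts)
open Cycle public

CycEdge : ∀ {n} {G : Graph n} → Cycle G → Fin n → Fin n → Set
CycEdge c u v = ((u , v) LM.∈ cycEdges (verts c)) ⊎ ((v , u) LM.∈ cycEdges (verts c))

-- Two cycles are the same (as subgraphs) iff they have the same edge set.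
SameCycle : ∀ {n} {G : Graph n} → Cycle G → Cycle G → Set
SameCycle c₁ c₂ = ∀ u v → CycEdge c₁ u v ⇔ CycEdge c₂ u v

Cactus : ∀ {n} → Graph n → Set
Cactus G = Connected G ×
  (∀ (c₁ c₂ : Cycle G) → ¬ SameCycle c₁ c₂ →
     ∀ x y → x LM.∈ verts c₁ → x LM.∈ verts c₂ → y LM.∈ verts c₁ → y LM.∈ verts c₂ → x ≡ y)

AtLeastTwoCycles : ∀ {n} → Graph n → Set
AtLeastTwoCycles G = Σ (Cycle G) λ c₁ → Σ (Cycle G) λ c₂ → ¬ SameCycle c₁ c₂

-- Zero forcing: the set of vertices eventually coloured blue from B
-- (least set containing B closed under the colour-change rule).
data Blue {n} (G : Graph n) (B : Subset n) : Fin n → Set where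
  init  : ∀ {v} → v ∈ B → Blue G B v
  force : ∀ {u v} → Blue G B u → Adj G u v →
          (∀ w → Adj G u w → w ≢ v → Blue G B w) → Blue G B v

ZeroForcingSet : ∀ {n} → Graph n → Subset n → Set
ZeroForcingSet G B = ∀ v → Blue G B v

ZeroForcingNumber : ∀ {n} → Graph n → ℕ → Set
ZeroForcingNumber {n} G k =
  (Σ (Subset n) λ B → ZeroForcingSet G B × ∣ B ∣ ≡ k) ×
  (∀ B → ZeroForcingSet G B → k ≤ ∣ B ∣)

-- A cactus contains no K₂,₃, since two distinct 4-cycles would share three
-- vertices.  In the complement, a blue vertex u can force v only if every other white
-- vertex is a neighbour of u in G; two distinct forcers would then have three common white
-- neighbours as soon as there are five white vertices.  So with five or more white
-- vertices nothing beyond a single vertex forced directly from B ever turns blue, and every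
-- zero forcing set of the complement has at least n − 4 elements.
--
-- Let a b c d be the 4-cycle with pendant neighbours x of a and y of b.  In a
-- cactus the six vertices a, b, c, d, x, y induce exactly the square and the two pendant
-- edges, so the second cycle of G must leave them and supplies a seventh vertex z; after
-- exchanging the roles of (a, x) and (b, y) we may assume z is not adjacent to a.  Then all
-- vertices but b, d, x, z form a zero forcing set of the complement: a forces z, c forces x,
-- y forces d and d forces b.

module Submission where

open import Defs
open import Data.Nat using (ℕ; suc; _+_; _∸_; _≤_; _<_; _≤?_; s≤s; z≤n)
open import Data.Nat.Properties
  using (≤-reflexive; ≤-trans; ≤-pred; ≤-antisym; m≤n⇒m≤1+n; ≰⇒>; m≤n+m∸n; m≤n+o⇒m∸n≤o; +-monoʳ-≤; +-comm;
         module ≤-Reasoning)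
open import Data.Fin using (Fin; _≟_) renaming (zero to fzero; suc to fsuc)
open import Data.Fin.Subset using (Subset; inside; outside; ⊤; ∁; _-_; ∣_∣; Nonempty)
  renaming (_∈_ to _∈ₛ_; _∉_ to _∉ₛ_)
open import Data.Fin.Subset.Properties
  using (p─⊥≡p; p─q⊆p; x∈p⇒∣p-x∣<∣p∣; x∈p∧x≢y⇒x∈p-y; ∈⊤; ∣⊤∣≡n; x∈∁p⇒x∉p; ∣∁p∣≡n∸∣p∣)
  renaming (_∈?_ to _∈ₛ?_)
open import Data.Vec using (_∷_; here; there)
open import Data.List using (List; []; _∷_; _++_; [_]; zip; length)
open import Data.List.Membership.Propositional using (_∈_; _∉_)
open import Data.List.Membership.Propositional.Properties using (∈-++⁻)
open import Data.List.Relation.Unary.Any using (here; there; satisfied)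
open import Data.List.Relation.Unary.All using (All; []; _∷_; all?)
import Data.List.Relation.Unary.All as All
open import Data.List.Relation.Unary.All.Properties using (All¬⇒¬Any; ¬Any⇒All¬; ¬All⇒Any¬)
open import Data.List.Relation.Unary.AllPairs using ([]; _∷_)
open import Data.List.Relation.Unary.Unique.Propositional using (Unique)
open import Data.Product using (_×_; _,_; -,_; Σ; ∃; ∃₂; ∃-syntax; proj₁; proj₂)
import Data.Product as Product
open import Data.Sum using (_⊎_; inj₁; inj₂)
open import Data.Empty using (⊥; ⊥-elim)
open import Relation.Nullary using (¬_; yes; no)
open import Relation.Binary.PropositionalEquality
  using (_≡_; _≢_; refl; cong; subst; ≢-sym; module ≡-Reasoning) renaming (sym to ≡-sym)
open import Function.Bundles using (Equivalence)
import Function.Properties.Equivalence as ⇔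

pattern ∈₀ = here refl
pattern ∈₁ = there ∈₀
pattern ∈₂ = there ∈₁
pattern ∈₃ = there ∈₂
pattern ∈₄ = there ∈₃
pattern ∈₅ = there ∈₄

module _ where

  private variable
    k n : ℕ
    p : Subset n
    x y : Fin n

  ∣p∣≤1+∣p-x∣ : ∀ (p : Subset n) x → ∣ p ∣ ≤ suc ∣ p - x ∣
  ∣p∣≤1+∣p-x∣ (inside  ∷ p) fzero    = s≤s (≤-reflexive (cong ∣_∣ (≡-sym (p─⊥≡p p))))
  ∣p∣≤1+∣p-x∣ (outside ∷ p) fzero    = m≤n⇒m≤1+n (≤-reflexive (cong ∣_∣ (≡-sym (p─⊥≡p p))))
  ∣p∣≤1+∣p-x∣ (inside  ∷ p) (fsuc x) = s≤s (∣p∣≤1+∣p-x∣ p x)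
  ∣p∣≤1+∣p-x∣ (outside ∷ p) (fsuc x) = ∣p∣≤1+∣p-x∣ p x

  x∈p⇒1+∣p-x∣≡∣p∣ : x ∈ₛ p → suc ∣ p - x ∣ ≡ ∣ p ∣
  x∈p⇒1+∣p-x∣≡∣p∣ {x = x} {p = p} x∈p = ≤-antisym (x∈p⇒∣p-x∣<∣p∣ x∈p) (∣p∣≤1+∣p-x∣ p x)

  x∈p-y⇒x∈p : ∀ (p : Subset n) y → x ∈ₛ p - y → x ∈ₛ p
  x∈p-y⇒x∈p p y = p─q⊆p p _

  x∈p-y⇒x≢y : ∀ (p : Subset n) y → x ∈ₛ p - y → x ≢ y
  x∈p-y⇒x≢y {x = fzero}  (_ ∷ _) _ () refl
  x∈p-y⇒x≢y {x = fsuc x} (_ ∷ p) _ (there x∈p-y) refl = x∈p-y⇒x≢y p x x∈p-y refl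

  nonempty : ∀ (p : Subset n) → 0 < ∣ p ∣ → Nonempty p
  nonempty (inside  ∷ p) _     = fzero , here
  nonempty (outside ∷ p) 0<∣p∣ = Product.map fsuc there (nonempty p 0<∣p∣)

  shrink : ∀ (p : Subset n) x → suc k ≤ ∣ p ∣ → k ≤ ∣ p - x ∣
  shrink p x k<∣p∣ = ≤-pred (≤-trans k<∣p∣ (∣p∣≤1+∣p-x∣ p x))

  three-distinct : 3 ≤ ∣ p ∣ →
    ∃[ x₁ ] ∃[ x₂ ] ∃[ x₃ ] (x₁ ≢ x₂ × x₁ ≢ x₃ × x₂ ≢ x₃) × All (_∈ₛ p) (x₁ ∷ x₂ ∷ x₃ ∷ [])
  three-distinct {p = p} 3≤∣p∣
    with x₁ , x₁∈p       ← nonempty p (≤-trans (s≤s z≤n) 3≤∣p∣)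
    with x₂ , x₂∈p-x₁    ← nonempty (p - x₁) (≤-trans (s≤s z≤n) (shrink p x₁ 3≤∣p∣))
    with x₃ , x₃∈p-x₁-x₂ ← nonempty (p - x₁ - x₂) (shrink (p - x₁) x₂ (shrink p x₁ 3≤∣p∣))
    = x₁ , x₂ , x₃
    , (≢-sym (x∈p-y⇒x≢y p x₁ x₂∈p-x₁) , ≢-sym (x∈p-y⇒x≢y p x₁ x₃∈p-x₁) , ≢-sym (x∈p-y⇒x≢y (p - x₁) x₂ x₃∈p-x₁-x₂))
    , x₁∈p ∷ x∈p-y⇒x∈p p x₁ x₂∈p-x₁ ∷ x∈p-y⇒x∈p p x₁ x₃∈p-x₁ ∷ []
    where
    x₃∈p-x₁ : x₃ ∈ₛ p - x₁
    x₃∈p-x₁ = x∈p-y⇒x∈p (p - x₁) x₂ x₃∈p-x₁-x₂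

module _ {A B : Set} {s : A} {t : B} where

  zip-∈⁻ˡ : ∀ {xs : List A} {ys : List B} → (s , t) ∈ zip xs ys → s ∈ xs
  zip-∈⁻ˡ {_ ∷ _} {_ ∷ _} ∈₀          = ∈₀
  zip-∈⁻ˡ {_ ∷ _} {_ ∷ _} (there st∈) = there (zip-∈⁻ˡ st∈)

  zip-∈⁻ʳ : ∀ {xs : List A} {ys : List B} → (s , t) ∈ zip xs ys → t ∈ ys
  zip-∈⁻ʳ {_ ∷ _} {_ ∷ _} ∈₀          = ∈₀
  zip-∈⁻ʳ {_ ∷ _} {_ ∷ _} (there st∈) = there (zip-∈⁻ʳ st∈)

module _ {A : Set} where

  private variable
    s t v : A

  cycEdges-∈⁻ˡ : ∀ (xs : List A) → (s , t) ∈ cycEdges xs → s ∈ xs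
  cycEdges-∈⁻ˡ (x ∷ xs) = zip-∈⁻ˡ

  cycEdges-∈⁻ʳ : ∀ (xs : List A) → (s , t) ∈ cycEdges xs → t ∈ xs
  cycEdges-∈⁻ʳ (x ∷ xs) st∈ with ∈-++⁻ xs (zip-∈⁻ʳ st∈)
  ... | inj₁ t∈xs = there t∈xs
  ... | inj₂ ∈₀   = ∈₀

  zip-successor : ∀ (x : A) xs r → v ∈ x ∷ xs → ∃ λ s → (v , s) ∈ zip (x ∷ xs) (xs ++ [ r ])
  zip-successor x []       r ∈₀         = r , ∈₀
  zip-successor x (y ∷ xs) r ∈₀         = y , ∈₀
  zip-successor x (y ∷ xs) r (there v∈) = Product.map₂ there (zip-successor y xs r v∈)

  cycEdges-successor : ∀ (xs : List A) → v ∈ xs → ∃ λ s → (v , s) ∈ cycEdges xs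
  cycEdges-successor (x ∷ xs) = zip-successor x xs x

module _ {n : ℕ} where

  open import Data.List.Membership.DecPropositional (_≟_ {n}) using (_∈?_)

  avoid-pair : ∀ {xs : List (Fin n)} → Unique xs → 3 ≤ length xs →
               ∀ s t → ∃ λ w → w ∈ xs × w ≢ s × w ≢ t
  avoid-pair {[]}         _ ()               _ _
  avoid-pair {_ ∷ []}     _ (s≤s ())         _ _
  avoid-pair {_ ∷ _ ∷ []} _ (s≤s (s≤s ()))   _ _
  avoid-pair {x₁ ∷ x₂ ∷ x₃ ∷ _} ((x₁≢x₂ ∷ x₁≢x₃ ∷ _) ∷ (x₂≢x₃ ∷ _) ∷ _) _ s t
    with x₁ ≟ s | x₁ ≟ t
  ... | no x₁≢s  | no x₁≢t  = x₁ , ∈₀ , x₁≢s , x₁≢t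
  ... | yes refl | yes refl = x₂ , ∈₁ , ≢-sym x₁≢x₂ , ≢-sym x₁≢x₂
  ... | yes refl | no _ with x₂ ≟ t
  ...   | no x₂≢t  = x₂ , ∈₁ , ≢-sym x₁≢x₂ , x₂≢t
  ...   | yes refl = x₃ , ∈₂ , ≢-sym x₁≢x₃ , ≢-sym x₂≢x₃
  avoid-pair {x₁ ∷ x₂ ∷ x₃ ∷ _} ((x₁≢x₂ ∷ x₁≢x₃ ∷ _) ∷ (x₂≢x₃ ∷ _) ∷ _) _ s t
      | no _ | yes refl with x₂ ≟ s
  ...   | no x₂≢s  = x₂ , ∈₁ , x₂≢s , ≢-sym x₁≢x₂
  ...   | yes refl = x₃ , ∈₂ , ≢-sym x₂≢x₃ , ≢-sym x₁≢x₃

  outside-element : ∀ {xs ys : List (Fin n)} → ¬ All (_∈ ys) xs → ∃ λ z → All (z ≢_) ys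
  outside-element {xs} {ys} xs⊈ys with z , z∉ys ← satisfied (¬All⇒Any¬ (_∈? ys) xs xs⊈ys) =
    z , ¬Any⇒All¬ ys z∉ys

module _ {n : ℕ} (G : Graph n) where

  open import Data.List.Membership.DecPropositional (_≟_ {n}) using (_∈?_)

  private variable
    a b c d p q s t u u' v w x y z : Fin n

  private
    H : Graph n
    H = complement G

  adj⇒≢ : Adj G u v → u ≢ v
  adj⇒≢ uv refl = irrefl G uv

  cycle-successor : (K : Cycle G) → v ∈ verts K → ∃ λ s → Adj G v s × s ∈ verts K
  cycle-successor K v∈K with s , vs∈ ← cycEdges-successor (verts K) v∈K =
    s , All.lookup (closed K) vs∈ , cycEdges-∈⁻ʳ (verts K) vs∈

  triangle : Adj G a b → Adj G b c → Adj G c a → Cycle G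
  triangle ab bc ca = record
    { verts    = _ ∷ _ ∷ _ ∷ []
    ; len≥3    = s≤s (s≤s (s≤s z≤n))
    ; distinct = (adj⇒≢ ab ∷ ≢-sym (adj⇒≢ ca) ∷ []) ∷ (adj⇒≢ bc ∷ []) ∷ [] ∷ []
    ; closed   = ab ∷ bc ∷ ca ∷ []
    }

  record Square (a b c d : Fin n) : Set where
    constructor mkSquare
    field
      a≢c : a ≢ c
      b≢d : b ≢ d
      ab  : Adj G a b
      bc  : Adj G b c
      cd  : Adj G c d
      da  : Adj G d a

    cycle : Cycle G
    cycle = record
      { verts    = a ∷ b ∷ c ∷ d ∷ []
      ; len≥3    = s≤s (s≤s (s≤s z≤n))
      ; distinct = (adj⇒≢ ab ∷ a≢c ∷ ≢-sym (adj⇒≢ da) ∷ []) ∷ (adj⇒≢ bc ∷ b≢d ∷ []) ∷ (adj⇒≢ cd ∷ []) ∷ [] ∷ []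
      ; closed   = ab ∷ bc ∷ cd ∷ da ∷ []
      }

  rotate : Square a b c d → Square b c d a
  rotate (mkSquare a≢c b≢d ab bc cd da) = mkSquare b≢d (≢-sym a≢c) bc cd da ab

  reflect : Square a b c d → Square b a d c
  reflect (mkSquare a≢c b≢d ab bc cd da) = mkSquare b≢d a≢c (sym G ab) (sym G da) (sym G cd) (sym G bc)

  reverse : Square a b c d → Square a d c b
  reverse (mkSquare a≢c b≢d ab bc cd da) = mkSquare a≢c (≢-sym b≢d) (sym G da) (sym G cd) (sym G bc) (sym G ab)

  Off : Fin n → Fin n → Fin n → Fin n → Fin n → Set
  Off x a b c d = All (x ≢_) (a ∷ b ∷ c ∷ d ∷ [])

  record PendantSquare (a b c d x y : Fin n) : Set where
    field
      square    : Square a b c d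
      a~x       : Adj G a x
      b~y       : Adj G b y
      x-off     : Off x a b c d
      y-off     : Off y a b c d
      a≁c       : ¬ Adj G a c
      b≁d       : ¬ Adj G b d
      x-pendant : All (λ v → ¬ Adj G x v) (b ∷ c ∷ d ∷ y ∷ [])
      y-pendant : All (λ v → ¬ Adj G y v) (a ∷ c ∷ d ∷ x ∷ [])

  swap-pairs : ∀ {P : Fin n → Set} → All P (a ∷ b ∷ c ∷ d ∷ []) → All P (b ∷ a ∷ d ∷ c ∷ [])
  swap-pairs (pa ∷ pb ∷ pc ∷ pd ∷ []) = pb ∷ pa ∷ pd ∷ pc ∷ []

  swap-middle : ∀ {P : Fin n → Set} → All P (a ∷ b ∷ c ∷ d ∷ []) → All P (a ∷ c ∷ b ∷ d ∷ [])
  swap-middle (pa ∷ pb ∷ pc ∷ pd ∷ []) = pa ∷ pc ∷ pb ∷ pd ∷ []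

  flip : PendantSquare a b c d x y → PendantSquare b a d c y x
  flip P = record
    { square    = reflect square
    ; a~x       = b~y
    ; b~y       = a~x
    ; x-off     = swap-pairs y-off
    ; y-off     = swap-pairs x-off
    ; a≁c       = b≁d
    ; b≁d       = a≁c
    ; x-pendant = swap-middle y-pendant
    ; y-pendant = swap-middle x-pendant
    }
    where open PendantSquare P

  K₂,₃-free : Set
  K₂,₃-free = ∀ {u u' x₁ x₂ x₃} → u ≢ u' → x₁ ≢ x₂ → x₁ ≢ x₃ → x₂ ≢ x₃ →
    ¬ All (λ x → Adj G u x × Adj G u' x) (x₁ ∷ x₂ ∷ x₃ ∷ [])

  Forces : (Fin n → Set) → Fin n → Fin n → Set
  Forces S u v = Adj H u v × (∀ w → Adj H u w → w ≢ v → S w)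

  forcer-adjacent : ∀ {S} → Forces S u v → x ≢ u → x ≢ v → ¬ S x → Adj G u x
  forcer-adjacent {u} {v} {x} (_ , others) x≢u x≢v ¬Sx with dec G u x
  ... | yes u~x = u~x
  ... | no u≁x  = ⊥-elim (¬Sx (others x (≢-sym x≢u , u≁x) x≢v))

  module _ (k23 : K₂,₃-free) (B : Subset n) (many-white : 5 ≤ ∣ ∁ B ∣) where

    Covers : Fin n → Fin n → Fin n → Set
    Covers u s t = ∀ {x} → x ∉ₛ B → x ≢ s → x ≢ t → Adj G u x

    covers-unique : Covers u s t → Covers u' s t → u ≡ u'
    covers-unique {u} {s} {t} {u'} covers covers' with u ≟ u'
    ... | yes u≡u' = u≡u'
    ... | no u≢u'
      with x₁ , x₂ , x₃ , (x₁≢x₂ , x₁≢x₃ , x₂≢x₃) , x₁∈ ∷ x₂∈ ∷ x₃∈ ∷ []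
             ← three-distinct {p = ∁ B - s - t} (shrink (∁ B - s) t (shrink (∁ B) s many-white))
      = ⊥-elim (k23 u≢u' x₁≢x₂ x₁≢x₃ x₂≢x₃ (both x₁∈ ∷ both x₂∈ ∷ both x₃∈ ∷ []))
      where
      both : x ∈ₛ ∁ B - s - t → Adj G u x × Adj G u' x
      both {x} x∈ = covers x∉B x≢s x≢t , covers' x∉B x≢s x≢t
        where
        x∈∁B-s : x ∈ₛ ∁ B - s
        x∈∁B-s = x∈p-y⇒x∈p (∁ B - s) t x∈
        x∉B : x ∉ₛ B
        x∉B = x∈∁p⇒x∉p (x∈p-y⇒x∈p (∁ B) s x∈∁B-s)
        x≢s : x ≢ s
        x≢s = x∈p-y⇒x≢y (∁ B) s x∈∁B-s
        x≢t : x ≢ t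
        x≢t = x∈p-y⇒x≢y (∁ B - s) t x∈

    record ForcedFromB (v : Fin n) : Set where
      field
        white    : v ∉ₛ B
        forcer   : Fin n
        forcer∈B : forcer ∈ₛ B
        forces   : Forces (_∈ₛ B) forcer v

      covers : Covers forcer v v
      covers x∉B x≢v _ = forcer-adjacent forces (λ { refl → x∉B forcer∈B }) x≢v x∉B

    open ForcedFromB

    forced-unique : ForcedFromB u → ForcedFromB v → u ≡ v
    forced-unique {u} {v} Fu Fv with u ≟ v
    ... | yes u≡v = u≡v
    ... | no u≢v  = ⊥-elim (proj₂ (proj₁ (forces Fu)) (subst (λ w → Adj G w u) (≡-sym same-forcer) w~u))
      where
      w~u : Adj G (forcer Fv) u
      w~u = covers Fv (white Fu) u≢v u≢v
      same-forcer : forcer Fu ≡ forcer Fv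
      same-forcer = covers-unique (λ x∉B x≢u _ → covers Fu x∉B x≢u x≢u)
                                  (λ x∉B _ x≢v → covers Fv x∉B x≢v x≢v)

    -- The invariant behind the lower bound: with at least five white vertices, the vertices
    -- that ever turn blue are those of B and those forced directly from B.
    OneStep : Fin n → Set
    OneStep v = v ∈ₛ B ⊎ ForcedFromB v

    not-one-step : ForcedFromB v → x ∉ₛ B → x ≢ v → ¬ OneStep x
    not-one-step Fv x∉B x≢v (inj₁ x∈B) = x∉B x∈B
    not-one-step Fv x∉B x≢v (inj₂ Fx)  = x≢v (forced-unique Fx Fv)

    one-step-closed : OneStep u → Forces OneStep u v → OneStep v
    one-step-closed {u} {v} _ _ with v ∈ₛ? B
    ... | yes v∈B = inj₁ v∈B
    one-step-closed {u} {v} (inj₁ u∈B) u⇒v@(u~v , others) | no v∉B =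
      inj₂ record { white = v∉B ; forcer = u ; forcer∈B = u∈B ; forces = u~v , others∈B }
      where
      others∈B : ∀ w → Adj H u w → w ≢ v → w ∈ₛ B
      others∈B w u~w w≢v with others w u~w w≢v
      ... | inj₁ w∈B = w∈B
      ... | inj₂ Fw  = ⊥-elim (proj₂ u~v (subst (λ u → Adj G u v) (≡-sym same-forcer) (covers Fw v∉B v≢w v≢w)))
        where
        v≢w : v ≢ w
        v≢w = ≢-sym w≢v
        same-forcer : u ≡ forcer Fw
        same-forcer = covers-unique {t = w}
          (λ x∉B x≢v x≢w → forcer-adjacent u⇒v (λ { refl → x∉B u∈B }) x≢v (not-one-step Fw x∉B x≢w))
          (λ x∉B _ x≢w → covers Fw x∉B x≢w x≢w)
    one-step-closed {u} {v} (inj₂ Fu) u⇒v | no _ =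
      ⊥-elim (white Fu (subst (_∈ₛ B) (≡-sym same-forcer) (forcer∈B Fu)))
      where
      same-forcer : u ≡ forcer Fu
      same-forcer = covers-unique {t = v}
        (λ x∉B x≢u x≢v → forcer-adjacent u⇒v x≢u x≢v (not-one-step Fu x∉B x≢u))
        (λ x∉B x≢u _ → covers Fu x∉B x≢u x≢u)

    blue⇒one-step : Blue H B v → OneStep v
    blue⇒one-step (init v∈B) = inj₁ v∈B
    blue⇒one-step (force u-blue u~v others) =
      one-step-closed (blue⇒one-step u-blue) (u~v , λ w u~w w≢v → blue⇒one-step (others w u~w w≢v))

    not-zero-forcing : ¬ ZeroForcingSet H B
    not-zero-forcing zfs
      with x₁ , x₂ , _ , (x₁≢x₂ , _) , x₁∈∁B ∷ x₂∈∁B ∷ _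
             ← three-distinct {p = ∁ B} (≤-trans (s≤s (s≤s (s≤s z≤n))) many-white)
      = x₁≢x₂ (forced-unique (forced x₁∈∁B) (forced x₂∈∁B))
      where
      forced : x ∈ₛ ∁ B → ForcedFromB x
      forced {x} x∈∁B with blue⇒one-step (zfs x)
      ... | inj₁ x∈B = ⊥-elim (x∈∁p⇒x∉p x∈∁B x∈B)
      ... | inj₂ Fx  = Fx

  complement-zero-forcing-lower-bound : K₂,₃-free → ∀ B → ZeroForcingSet H B → n ∸ 4 ≤ ∣ B ∣
  complement-zero-forcing-lower-bound k23 B zfs = m≤n+o⇒m∸n≤o n 4 (begin
    n                   ≤⟨ m≤n+m∸n n ∣ B ∣ ⟩
    ∣ B ∣ + (n ∸ ∣ B ∣)  ≡⟨ cong (∣ B ∣ +_) (≡-sym (∣∁p∣≡n∸∣p∣ B)) ⟩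
    ∣ B ∣ + ∣ ∁ B ∣      ≤⟨ +-monoʳ-≤ ∣ B ∣ few-white ⟩
    ∣ B ∣ + 4           ≡⟨ +-comm ∣ B ∣ 4 ⟩
    4 + ∣ B ∣           ∎)
    where
    open ≤-Reasoning
    few-white : ∣ ∁ B ∣ ≤ 4
    few-white with 5 ≤? ∣ ∁ B ∣
    ... | yes many-white = ⊥-elim (not-zero-forcing k23 B many-white zfs)
    ... | no ¬many-white = ≤-pred (≰⇒> ¬many-white)

  module _ {a b c d x y z : Fin n} (P : PendantSquare a b c d x y)
           (z-off : Off z a b c d) (z≢x : z ≢ x) (z≢y : z ≢ y) (z≁a : ¬ Adj G z a) where

    open PendantSquare P
    open Square square

    private
      B : Subset n
      B = ⊤ - b - d - x - z

      R : List (Fin n)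
      R = b ∷ d ∷ x ∷ z ∷ []

      unremoved : v ≢ b → v ≢ d → v ≢ x → v ≢ z → Blue H B v
      unremoved v≢b v≢d v≢x v≢z =
        init (x∈p∧x≢y⇒x∈p-y (x∈p∧x≢y⇒x∈p-y (x∈p∧x≢y⇒x∈p-y (x∈p∧x≢y⇒x∈p-y ∈⊤ v≢b) v≢d) v≢x) v≢z)

      force-last : Blue H B u → Adj H u v → (∀ {w} → Adj H u w → w ≢ v → w ∈ R → Blue H B w) → Blue H B v
      force-last {u} {v} u-blue u~v removed = force u-blue u~v others
        where
        others : ∀ w → Adj H u w → w ≢ v → Blue H B w
        others w u~w w≢v with w ∈? R
        ... | yes w∈R = removed u~w w≢v w∈R
        ... | no w∉R with w≢b ∷ w≢d ∷ w≢x ∷ w≢z ∷ [] ← ¬Any⇒All¬ R w∉R = unremoved w≢b w≢d w≢x w≢z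

      x≢c : x ≢ c
      x≢c = All.lookup x-off ∈₂

      y≢x : y ≢ x
      y≢x refl = All.lookup x-pendant ∈₀ (sym G b~y)

      z-blue : Blue H B z
      z-blue = force-last (unremoved (adj⇒≢ ab) (≢-sym (adj⇒≢ da)) (adj⇒≢ a~x) (≢-sym (All.lookup z-off ∈₀)))
                          (≢-sym (All.lookup z-off ∈₀) , λ a~z → z≁a (sym G a~z)) λ where
        (_ , a≁b) _ ∈₀ → ⊥-elim (a≁b ab)
        (_ , a≁d) _ ∈₁ → ⊥-elim (a≁d (sym G da))
        (_ , a≁x) _ ∈₂ → ⊥-elim (a≁x a~x)
        _ z≢z ∈₃       → ⊥-elim (z≢z refl)

      x-blue : Blue H B x
      x-blue = force-last (unremoved (≢-sym (adj⇒≢ bc)) (adj⇒≢ cd) (≢-sym x≢c) (≢-sym (All.lookup z-off ∈₂)))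
                          (≢-sym x≢c , λ c~x → All.lookup x-pendant ∈₁ (sym G c~x)) λ where
        (_ , c≁b) _ ∈₀ → ⊥-elim (c≁b (sym G bc))
        (_ , c≁d) _ ∈₁ → ⊥-elim (c≁d cd)
        _ x≢x ∈₂       → ⊥-elim (x≢x refl)
        _ _ ∈₃         → z-blue

      d-blue : Blue H B d
      d-blue = force-last (unremoved (≢-sym (adj⇒≢ b~y)) (All.lookup y-off ∈₃) y≢x (≢-sym z≢y))
                          (All.lookup y-off ∈₃ , All.lookup y-pendant ∈₂) λ where
        (_ , y≁b) _ ∈₀ → ⊥-elim (y≁b (sym G b~y))
        _ d≢d ∈₁       → ⊥-elim (d≢d refl)
        _ _ ∈₂         → x-blue
        _ _ ∈₃         → z-blue

      b-blue : Blue H B b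
      b-blue = force-last d-blue (≢-sym b≢d , λ d~b → b≁d (sym G d~b)) λ where
        _ b≢b ∈₀ → ⊥-elim (b≢b refl)
        _ _ ∈₁   → d-blue
        _ _ ∈₂   → x-blue
        _ _ ∈₃   → z-blue

      zero-forcing : ZeroForcingSet H B
      zero-forcing v with v ∈? R
      ... | yes ∈₀ = b-blue
      ... | yes ∈₁ = d-blue
      ... | yes ∈₂ = x-blue
      ... | yes ∈₃ = z-blue
      ... | no v∉R with v≢b ∷ v≢d ∷ v≢x ∷ v≢z ∷ [] ← ¬Any⇒All¬ R v∉R = unremoved v≢b v≢d v≢x v≢z

      4+∣B∣≡n : 4 + ∣ B ∣ ≡ n
      4+∣B∣≡n = begin
        4 + ∣ ⊤ - b - d - x - z ∣ ≡⟨ cong (3 +_) (x∈p⇒1+∣p-x∣≡∣p∣ z∈⊤-b-d-x) ⟩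
        3 + ∣ ⊤ - b - d - x ∣     ≡⟨ cong (2 +_) (x∈p⇒1+∣p-x∣≡∣p∣ x∈⊤-b-d) ⟩
        2 + ∣ ⊤ - b - d ∣         ≡⟨ cong (1 +_) (x∈p⇒1+∣p-x∣≡∣p∣ d∈⊤-b) ⟩
        1 + ∣ ⊤ - b ∣             ≡⟨ x∈p⇒1+∣p-x∣≡∣p∣ {x = b} {p = ⊤} ∈⊤ ⟩
        ∣ ⊤ {n} ∣                 ≡⟨ ∣⊤∣≡n n ⟩
        n                         ∎
        where
        open ≡-Reasoning
        d∈⊤-b : d ∈ₛ ⊤ - b
        d∈⊤-b = x∈p∧x≢y⇒x∈p-y ∈⊤ (≢-sym b≢d)
        x∈⊤-b-d : x ∈ₛ ⊤ - b - d
        x∈⊤-b-d = x∈p∧x≢y⇒x∈p-y (x∈p∧x≢y⇒x∈p-y ∈⊤ (All.lookup x-off ∈₁)) (All.lookup x-off ∈₃)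
        z∈⊤-b-d-x : z ∈ₛ ⊤ - b - d - x
        z∈⊤-b-d-x = x∈p∧x≢y⇒x∈p-y (x∈p∧x≢y⇒x∈p-y (x∈p∧x≢y⇒x∈p-y ∈⊤ (All.lookup z-off ∈₁))
                                                   (All.lookup z-off ∈₃)) z≢x

    pendant-square-forcing-set : ∃ λ B → ZeroForcingSet H B × ∣ B ∣ ≡ n ∸ 4
    pendant-square-forcing-set = B , zero-forcing , cong (_∸ 4) 4+∣B∣≡n

  AtMostOneCommonVertex : Set
  AtMostOneCommonVertex = ∀ (c₁ c₂ : Cycle G) → ¬ SameCycle c₁ c₂ →
    ∀ x y → x ∈ verts c₁ → x ∈ verts c₂ → y ∈ verts c₁ → y ∈ verts c₂ → x ≡ y

  module _ (meet : AtMostOneCommonVertex) where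

    meet-once : (K K' : Cycle G) → t ∈ verts K → t ∉ verts K' →
                u ∈ verts K → u ∈ verts K' → v ∈ verts K → v ∈ verts K' → u ≡ v
    meet-once K K' t∈K t∉K' = meet K K' K≉K' _ _
      where
      K≉K' : ¬ SameCycle K K'
      K≉K' K≈K' with s , ts∈K ← cycEdges-successor (verts K) t∈K
                with Equivalence.to (K≈K' _ s) (inj₁ ts∈K)
      ... | inj₁ ts∈K' = t∉K' (cycEdges-∈⁻ˡ (verts K') ts∈K')
      ... | inj₂ st∈K' = t∉K' (cycEdges-∈⁻ʳ (verts K') st∈K')

    square-chordless : Square a b c d → ¬ Adj G a c
    square-chordless {a} {b} {c} {d} S a~c =
      adj⇒≢ ab (meet-once cycle (triangle ab bc (sym G a~c)) ∈₃ d∉abc ∈₀ ∈₀ ∈₁ ∈₁)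
      where
      open Square S
      d∉abc : d ∉ a ∷ b ∷ c ∷ []
      d∉abc = All¬⇒¬Any (adj⇒≢ da ∷ ≢-sym b≢d ∷ ≢-sym (adj⇒≢ cd) ∷ [])

    no-triangle-on-cycle-edge : (K : Cycle G) → u ∈ verts K → v ∈ verts K → Adj G u v →
                                Adj G u t → Adj G v t → t ∉ verts K → ⊥
    no-triangle-on-cycle-edge K u∈K v∈K u~v u~t v~t t∉K =
      adj⇒≢ u~v (meet-once (triangle u~v v~t (sym G u~t)) K ∈₂ t∉K ∈₀ u∈K ∈₁ v∈K)

    cactus-K₂,₃-free : K₂,₃-free
    cactus-K₂,₃-free {u} {u'} {x₁} {x₂} {x₃} u≢u' x₁≢x₂ x₁≢x₃ x₂≢x₃ ((ux₁ , u'x₁) ∷ (ux₂ , u'x₂) ∷ (ux₃ , u'x₃) ∷ []) =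
      adj⇒≢ ux₂ (meet-once (Square.cycle ux₁u'x₂) (Square.cycle ux₂u'x₃) ∈₁ x₁∉ux₂u'x₃ ∈₀ ∈₀ ∈₃ ∈₁)
      where
      ux₁u'x₂ : Square u x₁ u' x₂
      ux₁u'x₂ = mkSquare u≢u' x₁≢x₂ ux₁ (sym G u'x₁) u'x₂ (sym G ux₂)
      ux₂u'x₃ : Square u x₂ u' x₃
      ux₂u'x₃ = mkSquare u≢u' x₂≢x₃ ux₂ (sym G u'x₂) u'x₃ (sym G ux₃)
      x₁∉ux₂u'x₃ : x₁ ∉ u ∷ x₂ ∷ u' ∷ x₃ ∷ []
      x₁∉ux₂u'x₃ = All¬⇒¬Any (≢-sym (adj⇒≢ ux₁) ∷ x₁≢x₂ ∷ ≢-sym (adj⇒≢ u'x₁) ∷ x₁≢x₃ ∷ [])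

    reorient-square : Square a b c d → let L = a ∷ b ∷ c ∷ d ∷ [] in p ∈ L → q ∈ L → Adj G p q →
                      ∃₂ λ c' d' → Square p q c' d' × All (_∈ L) (p ∷ q ∷ c' ∷ d' ∷ [])
    reorient-square S ∈₀ ∈₀ p~q = ⊥-elim (irrefl G p~q)
    reorient-square S ∈₀ ∈₁ p~q = -, -, S , ∈₀ ∷ ∈₁ ∷ ∈₂ ∷ ∈₃ ∷ []
    reorient-square S ∈₀ ∈₂ p~q = ⊥-elim (square-chordless S p~q)
    reorient-square S ∈₀ ∈₃ p~q = -, -, reverse S , ∈₀ ∷ ∈₃ ∷ ∈₂ ∷ ∈₁ ∷ []
    reorient-square S ∈₁ ∈₀ p~q = -, -, reflect S , ∈₁ ∷ ∈₀ ∷ ∈₃ ∷ ∈₂ ∷ []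
    reorient-square S ∈₁ ∈₁ p~q = ⊥-elim (irrefl G p~q)
    reorient-square S ∈₁ ∈₂ p~q = -, -, rotate S , ∈₁ ∷ ∈₂ ∷ ∈₃ ∷ ∈₀ ∷ []
    reorient-square S ∈₁ ∈₃ p~q = ⊥-elim (square-chordless (rotate S) p~q)
    reorient-square S ∈₂ ∈₀ p~q = ⊥-elim (square-chordless (rotate (rotate S)) p~q)
    reorient-square S ∈₂ ∈₁ p~q = -, -, reflect (rotate S) , ∈₂ ∷ ∈₁ ∷ ∈₀ ∷ ∈₃ ∷ []
    reorient-square S ∈₂ ∈₂ p~q = ⊥-elim (irrefl G p~q)
    reorient-square S ∈₂ ∈₃ p~q = -, -, rotate (rotate S) , ∈₂ ∷ ∈₃ ∷ ∈₀ ∷ ∈₁ ∷ []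
    reorient-square S ∈₃ ∈₀ p~q = -, -, rotate (rotate (rotate S)) , ∈₃ ∷ ∈₀ ∷ ∈₁ ∷ ∈₂ ∷ []
    reorient-square S ∈₃ ∈₁ p~q = ⊥-elim (square-chordless (rotate (rotate (rotate S))) p~q)
    reorient-square S ∈₃ ∈₂ p~q = -, -, reflect (rotate (rotate S)) , ∈₃ ∷ ∈₂ ∷ ∈₁ ∷ ∈₀ ∷ []
    reorient-square S ∈₃ ∈₃ p~q = ⊥-elim (irrefl G p~q)

    four-cycle-square : (C : Cycle G) → length (verts C) ≡ 4 → p ∈ verts C → q ∈ verts C → Adj G p q →
                        ∃₂ λ c d → Square p q c d × All (_∈ verts C) (p ∷ q ∷ c ∷ d ∷ [])
    four-cycle-square C |C|≡4 = square-of-list (verts C) |C|≡4 (distinct C) (closed C)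
      where
      square-of-list : ∀ (L : List (Fin n)) → length L ≡ 4 → Unique L →
                       All (λ e → Adj G (proj₁ e) (proj₂ e)) (cycEdges L) → p ∈ L → q ∈ L → Adj G p q →
                       ∃₂ λ c d → Square p q c d × All (_∈ L) (p ∷ q ∷ c ∷ d ∷ [])
      square-of-list (_ ∷ _ ∷ _ ∷ _ ∷ []) _ ((_ ∷ c₀≢c₂ ∷ _) ∷ (_ ∷ c₁≢c₃ ∷ _) ∷ _) (c₀c₁ ∷ c₁c₂ ∷ c₂c₃ ∷ c₃c₀ ∷ []) =
        reorient-square (mkSquare c₀≢c₂ c₁≢c₃ c₀c₁ c₁c₂ c₂c₃ c₃c₀)

    cactus-pendant-square : Square a b c d → Adj G a x → Off x a b c d → Adj G b y → Off y a b c d →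
                            PendantSquare a b c d x y
    cactus-pendant-square {a} {b} {c} {d} {x} {y} S a~x x-off@(_ ∷ x≢b ∷ _) b~y y-off@(y≢a ∷ _) = record
      { square    = S
      ; a~x       = a~x
      ; b~y       = b~y
      ; x-off     = x-off
      ; y-off     = y-off
      ; a≁c       = square-chordless S
      ; b≁d       = square-chordless (rotate S)
      ; x-pendant = x≁b ∷ x≁c ∷ x≁d ∷ x≁y ∷ []
      ; y-pendant = y≁a ∷ y≁c ∷ y≁d ∷ (λ y~x → x≁y (sym G y~x)) ∷ []
      }
      where
      open Square S
      x∉S : x ∉ verts cycle
      x∉S = All¬⇒¬Any x-off
      y∉S : y ∉ verts cycle
      y∉S = All¬⇒¬Any y-off
      x≁b : ¬ Adj G x b
      x≁b x~b = no-triangle-on-cycle-edge cycle ∈₀ ∈₁ ab a~x (sym G x~b) x∉S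
      x≁d : ¬ Adj G x d
      x≁d x~d = no-triangle-on-cycle-edge cycle ∈₀ ∈₃ (sym G da) a~x (sym G x~d) x∉S
      y≁a : ¬ Adj G y a
      y≁a y~a = no-triangle-on-cycle-edge cycle ∈₁ ∈₀ (sym G ab) b~y (sym G y~a) y∉S
      y≁c : ¬ Adj G y c
      y≁c y~c = no-triangle-on-cycle-edge cycle ∈₁ ∈₂ bc b~y (sym G y~c) y∉S
      x≁c : ¬ Adj G x c
      x≁c x~c = adj⇒≢ ab (meet-once (Square.cycle axcb) cycle ∈₁ x∉S ∈₀ ∈₀ ∈₃ ∈₁)
        where
        axcb : Square a x c b
        axcb = mkSquare a≢c x≢b a~x x~c (sym G bc) (sym G ab)
      y≁d : ¬ Adj G y d
      y≁d y~d = adj⇒≢ ab (meet-once (Square.cycle bdya) cycle ∈₁ y∉S ∈₃ ∈₀ ∈₀ ∈₁)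
        where
        bdya : Square b y d a
        bdya = mkSquare b≢d y≢a b~y y~d da ab
      x≁y : ¬ Adj G x y
      x≁y x~y = adj⇒≢ ab (meet-once (Square.cycle axyb) cycle ∈₁ x∉S ∈₀ ∈₀ ∈₃ ∈₁)
        where
        axyb : Square a x y b
        axyb = mkSquare (≢-sym y≢a) x≢b a~x x~y (sym G b~y) (sym G ab)

    module _ (P : PendantSquare a b c d x y) where

      open PendantSquare P
      open Square square

      L₆ : List (Fin n)
      L₆ = a ∷ b ∷ c ∷ d ∷ x ∷ y ∷ []

      x-neighbour : v ∈ L₆ → Adj G x v → v ≡ a
      x-neighbour ∈₀ _   = refl
      x-neighbour ∈₁ x~v = ⊥-elim (All.lookup x-pendant ∈₀ x~v)
      x-neighbour ∈₂ x~v = ⊥-elim (All.lookup x-pendant ∈₁ x~v)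
      x-neighbour ∈₃ x~v = ⊥-elim (All.lookup x-pendant ∈₂ x~v)
      x-neighbour ∈₄ x~v = ⊥-elim (irrefl G x~v)
      x-neighbour ∈₅ x~v = ⊥-elim (All.lookup x-pendant ∈₃ x~v)

      y-neighbour : v ∈ L₆ → Adj G y v → v ≡ b
      y-neighbour ∈₀ y~v = ⊥-elim (All.lookup y-pendant ∈₀ y~v)
      y-neighbour ∈₁ _   = refl
      y-neighbour ∈₂ y~v = ⊥-elim (All.lookup y-pendant ∈₁ y~v)
      y-neighbour ∈₃ y~v = ⊥-elim (All.lookup y-pendant ∈₂ y~v)
      y-neighbour ∈₄ y~v = ⊥-elim (All.lookup y-pendant ∈₃ y~v)
      y-neighbour ∈₅ y~v = ⊥-elim (irrefl G y~v)

      classify : v ∈ L₆ → v ∈ verts cycle ⊎ v ≡ x ⊎ v ≡ y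
      classify ∈₀ = inj₁ ∈₀
      classify ∈₁ = inj₁ ∈₁
      classify ∈₂ = inj₁ ∈₂
      classify ∈₃ = inj₁ ∈₃
      classify ∈₄ = inj₂ (inj₁ refl)
      classify ∈₅ = inj₂ (inj₂ refl)

      module _ (K : Cycle G) (K⊆L₆ : All (_∈ L₆) (verts K)) (K≉□ : ¬ SameCycle K cycle) where

        private
          common : u ∈ verts K → u ∈ verts cycle → v ∈ verts K → v ∈ verts cycle → u ≡ v
          common = meet K cycle K≉□ _ _

          a∈K : x ∈ verts K → a ∈ verts K
          a∈K x∈K with s , x~s , s∈K ← cycle-successor K x∈K =
            subst (_∈ verts K) (x-neighbour (All.lookup K⊆L₆ s∈K) x~s) s∈K

          b∈K : y ∈ verts K → b ∈ verts K
          b∈K y∈K with s , y~s , s∈K ← cycle-successor K y∈K =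
            subst (_∈ verts K) (y-neighbour (All.lookup K⊆L₆ s∈K) y~s) s∈K

          through-x : x ∈ verts K → ⊥
          through-x x∈K with w , w∈K , w≢a , w≢x ← avoid-pair (distinct K) (len≥3 K) a x
                        with classify (All.lookup K⊆L₆ w∈K)
          ... | inj₁ w∈□         = w≢a (≡-sym (common (a∈K x∈K) ∈₀ w∈K w∈□))
          ... | inj₂ (inj₁ refl) = w≢x refl
          ... | inj₂ (inj₂ refl) = adj⇒≢ ab (common (a∈K x∈K) ∈₀ (b∈K w∈K) ∈₁)

          through-y : y ∈ verts K → ⊥
          through-y y∈K with w , w∈K , w≢b , w≢y ← avoid-pair (distinct K) (len≥3 K) b y
                        with classify (All.lookup K⊆L₆ w∈K)
          ... | inj₁ w∈□         = w≢b (≡-sym (common (b∈K y∈K) ∈₁ w∈K w∈□))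
          ... | inj₂ (inj₁ refl) = adj⇒≢ ab (common (a∈K w∈K) ∈₀ (b∈K y∈K) ∈₁)
          ... | inj₂ (inj₂ refl) = w≢y refl

          avoiding-x-y : x ∉ verts K → y ∉ verts K → ⊥
          avoiding-x-y x∉K y∉K
            with u , u∈K , _ ← avoid-pair (distinct K) (len≥3 K) x x
            with v , v∈K , v≢u , _ ← avoid-pair (distinct K) (len≥3 K) u u
            = v≢u (common v∈K (on-square v∈K) u∈K (on-square u∈K))
            where
            on-square : w ∈ verts K → w ∈ verts cycle
            on-square w∈K with classify (All.lookup K⊆L₆ w∈K)
            ... | inj₁ w∈□         = w∈□
            ... | inj₂ (inj₁ refl) = ⊥-elim (x∉K w∈K)
            ... | inj₂ (inj₂ refl) = ⊥-elim (y∉K w∈K)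

        cycle-within-is-square : ⊥
        cycle-within-is-square with x ∈? verts K | y ∈? verts K
        ... | yes x∈K | _       = through-x x∈K
        ... | no _    | yes y∈K = through-y y∈K
        ... | no x∉K  | no y∉K  = avoiding-x-y x∉K y∉K

      -- SameCycle is not decidable, so a cycle inside L₆ is only shown to be ¬ ¬ the square;
      -- that suffices because the goal ⊥ is negative.
      extra-vertex : AtLeastTwoCycles G → ∃ λ z → All (z ≢_) L₆
      extra-vertex (c₁ , c₂ , c₁≉c₂) with all? (_∈? L₆) (verts c₁) | all? (_∈? L₆) (verts c₂)
      ... | no c₁⊈L₆  | _         = outside-element c₁⊈L₆
      ... | yes _     | no c₂⊈L₆  = outside-element c₂⊈L₆
      ... | yes c₁⊆L₆ | yes c₂⊆L₆ = ⊥-elim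
        (cycle-within-is-square c₁ c₁⊆L₆ λ c₁≈□ → cycle-within-is-square c₂ c₂⊆L₆ λ c₂≈□ →
          c₁≉c₂ λ u v → ⇔.trans (c₁≈□ u v) (⇔.sym (c₂≈□ u v)))

    pendant-square-on-4-cycle : (C : Cycle G) → length (verts C) ≡ 4 → p ∈ verts C → q ∈ verts C → Adj G p q →
                                Adj G p x → x ∉ verts C → Adj G q y → y ∉ verts C →
                                ∃₂ λ c d → PendantSquare p q c d x y
    pendant-square-on-4-cycle C |C|≡4 p∈C q∈C p~q p~x x∉C q~y y∉C
      with c , d , S , pqcd⊆C ← four-cycle-square C |C|≡4 p∈C q∈C p~q
      = c , d , cactus-pendant-square S p~x (off x∉C pqcd⊆C) q~y (off y∉C pqcd⊆C)
      where
      off : ∀ {x} {M : List (Fin n)} → x ∉ verts C → All (_∈ verts C) M → All (x ≢_) M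
      off x∉C = All.map λ v∈C x≡v → x∉C (subst (_∈ verts C) (≡-sym x≡v) v∈C)

    forcing-set : AtLeastTwoCycles G → PendantSquare a b c d x y →
                  ∃ λ B → ZeroForcingSet H B × ∣ B ∣ ≡ n ∸ 4
    forcing-set {a} {b} two P with z , z≢a ∷ z≢b ∷ z≢c ∷ z≢d ∷ z≢x ∷ z≢y ∷ [] ← extra-vertex P two
                              with dec G z a
    ... | no z≁a  = pendant-square-forcing-set P (z≢a ∷ z≢b ∷ z≢c ∷ z≢d ∷ []) z≢x z≢y z≁a
    ... | yes z~a = pendant-square-forcing-set (flip P) (z≢b ∷ z≢a ∷ z≢d ∷ z≢c ∷ []) z≢y z≢x z≁b
      where
      open Square (PendantSquare.square P)
      z≁b : ¬ Adj G z b
      z≁b z~b = no-triangle-on-cycle-edge cycle ∈₀ ∈₁ ab (sym G z~a) (sym G z~b)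
                  (All¬⇒¬Any (z≢a ∷ z≢b ∷ z≢c ∷ z≢d ∷ []))

-- The hypothesis 4 ≤ n is implied by the 4-cycle and not needed.
corollary4p9 : ∀ (n : ℕ) (G : Graph n) → 4 ≤ n → Cactus G → AtLeastTwoCycles G →
    (Σ (Cycle G) λ C → length (verts C) ≡ 4 ×
      (∃[ p ] ∃[ q ] (p ∈ verts C × q ∈ verts C × Adj G p q ×
        (∃[ x ] (Adj G p x × x ∉ verts C)) × (∃[ y ] (Adj G q y × y ∉ verts C))))) →
    ZeroForcingNumber (complement G) (n ∸ 4)
corollary4p9 n G _ (_ , meet) two (C , |C|≡4 , p , q , p∈C , q∈C , p~q , (x , p~x , x∉C) , (y , q~y , y∉C))
  with _ , _ , P ← pendant-square-on-4-cycle G meet C |C|≡4 p∈C q∈C p~q p~x x∉C q~y y∉C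
  = forcing-set G meet two P , complement-zero-forcing-lower-bound G (cactus-K₂,₃-free G meet)
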